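{- Let $\Gamma=(V,E,o,t)$ be a connected locally finite graph with finite modulus $\rho\colon I\to V$. The map $d^*\oplus\mathrm{id}\colon C^1(\Gamma_{\mathfrak m})=\mathbb{Z}^E\oplus\mathbb{Z}^I\to\widehat{\mathrm{Div}}{}^0_{\mathfrak m}(\Gamma)=\operatorname{im}(d^*)\oplus\mathbb{Z}^I$ induces an isomorphism $\chi_{\mathfrak m}\colon\mathrm{P}_{\mathfrak m}(\Gamma)\xrightarrow{\sim}\widehat{\mathrm{Cl}}{}^0_{\mathfrak m}(\Gamma)$.
   Context: Graph: $V\ne\emptyset$, $E$, $o,t\colon E\to V$, locally finite (finite fibres), countable, connected. Modulus: nonempty finite family $(w_i)_{i\in I}$, $\rho(i)=w_i$. $d\colon\mathbb{Z}^V\to\mathbb{Z}^E$, $(df)(e)=f(t(e))-f(o(e))$; $d^*\colon\mathbb{Z}^E\to\mathbb{Z}^V$, $(d^*\omega)(v)=\sum_{t(e)=v}\omega(e)-\sum_{o(e)=v}\omega(e)$; $\square_0=d^*d$; $\mathcal{H}^1(\Gamma)=\ker d^*$. Extended graph $\Gamma_{\mathfrak m}$: add vertex $\star$ and edges $e_i$, $o(e_i)=\star$, $t(e_i)=w_i$; its cochain complex is $\mathbb{Z}^V\oplus\mathbb{Z}\xrightarrow{d_{\mathfrak m}}\mathbb{Z}^E\oplus\mathbb{Z}^I$, $d_{\mathfrak m}(f,a)=(df,f\circ\rho-a)$, $H^1(\Gamma_{\mathfrak m})=\operatorname{coker}d_{\mathfrak m}$. $\beta_{\mathfrak m}\colon\mathcal{H}^1(\Gamma)\to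 H^1(\Gamma_{\mathfrak m})$, $\omega\mapsto$ class of $(\omega,0)$. $\mathfrak m$-Picard group: $\mathrm{P}_{\mathfrak m}(\Gamma)=H^1(\Gamma_{\mathfrak m})/\beta_{\mathfrak m}(\mathcal{H}^1(\Gamma))$. $\widehat{\mathrm{Cl}}{}^0_{\mathfrak m}(\Gamma)=(\operatorname{im}(d^*)\oplus\mathbb{Z}^I)/\{(\square_0f,f\circ\rho):f\in\mathbb{Z}^V\}$. -}

module Defs where

open import Data.Nat using (ℕ; suc)
open import Data.Integer using (ℤ; _+_; _-_; 0ℤ)
open import Data.Fin using (Fin)
open import Data.List using (List; foldr; map)
open import Data.List.Membership.Propositional using (_∈_)
open import Data.List.Relation.Unary.Unique.Propositional using (Unique)
open import Data.Product using (Σ; _×_; _,_; ∃; proj₁; proj₂)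
open import Function using (_∘_)
open import Function.Bundles using (_⇔_)
open import Function.Definitions using (Injective)
open import Relation.Binary.PropositionalEquality using (_≡_; refl)

sumℤ : List ℤ → ℤ
sumℤ = foldr _+_ 0ℤ

data Walk {V E : Set} (o t : E → V) : V → V → Set where
  stay : ∀ {v} → Walk o t v v
  fwd  : ∀ {u w} (e : E) → o e ≡ u → Walk o t (t e) w → Walk o t u w
  bwd  : ∀ {u w} (e : E) → t e ≡ u → Walk o t (o e) w → Walk o t u w

-- Local finiteness: for each vertex v the fibres t⁻¹(v) and o⁻¹(v) are
-- finite, given by duplicate-free lists enumerating exactly them.
record Graph : Set₁ where
  field
    V E   : Set
    o t   : E → V
    base  : V                                   -- V ≠ ∅
    encV  : V → ℕ
    encV-inj : Injective _≡_ _≡_ encV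
    encE  : E → ℕ
    encE-inj : Injective _≡_ _≡_ encE
    inE   : V → List E
    inE-spec : ∀ v e → (e ∈ inE v) ⇔ (t e ≡ v)
    inE-uniq : ∀ v → Unique (inE v)
    outE  : V → List E
    outE-spec : ∀ v e → (e ∈ outE v) ⇔ (o e ≡ v)
    outE-uniq : ∀ v → Unique (outE v)
    connected : ∀ u v → Walk o t u v

module _ (Γ : Graph) where
  open Graph Γ

  d : (V → ℤ) → (E → ℤ)
  d f e = f (t e) - f (o e)

  d* : (E → ℤ) → (V → ℤ)
  d* ω v = sumℤ (map ω (inE v)) - sumℤ (map ω (outE v))

  □₀ : (V → ℤ) → (V → ℤ)
  □₀ f = d* (d f)

  Harmonic : (E → ℤ) → Set
  Harmonic ω = ∀ v → d* ω v ≡ 0ℤ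

-- Modulus 𝔪: nonempty finite family (w_i)_{i ∈ I}, with I = Fin (suc n).
module _ (Γ : Graph) {n : ℕ} (ρ : Fin (suc n) → Graph.V Γ) where
  open Graph Γ

  C¹ : Set
  C¹ = (E → ℤ) × (Fin (suc n) → ℤ)

  -- Equivalence defining P_𝔪(Γ) = H¹(Γ_𝔪)/β_𝔪(ℋ¹(Γ))
  --   = C¹ / (im d_𝔪 + {(η,0) : η ∈ ker d*}),
  -- with d_𝔪(f,a) = (df, f∘ρ - a).
  _≈P_ : C¹ → C¹ → Set
  (ω , c) ≈P (ω' , c') =
    Σ (V → ℤ) λ f → Σ ℤ λ a → Σ (E → ℤ) λ η →
      Harmonic Γ η
      × (∀ e → ω e - ω' e ≡ d Γ f e + η e)
      × (∀ i → c i - c' i ≡ f (ρ i) - a)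

  Div0 : Set
  Div0 = (Σ (V → ℤ) λ u → ∃ λ (ω : E → ℤ) → ∀ v → d* Γ ω v ≡ u v)
         × (Fin (suc n) → ℤ)

  -- Equivalence defining Cl̂⁰_𝔪(Γ) = Div̂⁰_𝔪 / {(□₀ f, f∘ρ) : f ∈ ℤ^V}
  _≈Cl_ : Div0 → Div0 → Set
  ((u , _) , c) ≈Cl ((u' , _) , c') =
    Σ (V → ℤ) λ f →
      (∀ v → u v - u' v ≡ □₀ Γ f v) × (∀ i → c i - c' i ≡ f (ρ i))

  _+C¹_ : C¹ → C¹ → C¹
  (ω , c) +C¹ (ω' , c') = (λ e → ω e + ω' e) , (λ i → c i + c' i)

  χ : C¹ → Div0
  χ (ω , c) = ((d* Γ ω , ω , λ v → refl) , c)

-- χ is additive because d* is linear. If ω - ω' = d f + η with η ∈ ker d*, then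
-- d*ω - d*ω' = □₀ f; conversely, if d*ω - d*ω' = □₀ g, then η := (ω - ω') - d g
-- lies in ker d*. The constant a of d_𝔪(f, a) is absorbed into f, since d kills
-- constants.
module Submission where

open import Defs
open import Data.Nat using (ℕ; suc)
open import Data.Integer using (ℤ; _+_; _-_; 0ℤ)
open import Data.Integer.Properties using (+-commutativeSemigroup; +-identityʳ; +-inverseʳ; i≡j⇒i-j≡0)
open import Algebra.Properties.CommutativeSemigroup +-commutativeSemigroup
  using () renaming (interchange to +-interchange)
open import Data.Integer.Solver using (module +-*-Solver)
open import Data.Fin using (Fin)
open import Data.List using (List; []; _∷_; map)
open import Data.Product using (Σ; _×_; _,_; proj₁)
open import Relation.Binary.PropositionalEquality
  using (_≡_; refl; sym; trans; cong; cong₂; module ≡-Reasoning)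

open +-*-Solver

private
  minus-+-interchange : ∀ a b c d → (a - b) + (c - d) ≡ (a + c) - (b + d)
  minus-+-interchange = solve 4 (λ a b c d → (a :- b) :+ (c :- d) := (a :+ c) :- (b :+ d)) refl

  +-minus-interchange : ∀ a b c d → (a + b) - (c + d) ≡ (a - c) + (b - d)
  +-minus-interchange = solve 4 (λ a b c d → (a :+ b) :- (c :+ d) := (a :- c) :+ (b :- d)) refl

  minus-minus-interchange : ∀ a b c d → (a - b) - (c - d) ≡ (a - c) - (b - d)
  minus-minus-interchange = solve 4 (λ a b c d → (a :- b) :- (c :- d) := (a :- c) :- (b :- d)) refl

sumℤ-map-cong : {A : Set} {f g : A → ℤ} → (∀ x → f x ≡ g x) →
  ∀ l → sumℤ (map f l) ≡ sumℤ (map g l)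
sumℤ-map-cong f≗g []      = refl
sumℤ-map-cong f≗g (x ∷ l) = cong₂ _+_ (f≗g x) (sumℤ-map-cong f≗g l)

sumℤ-map-+ : {A : Set} (f g : A → ℤ) (l : List A) →
  sumℤ (map (λ x → f x + g x) l) ≡ sumℤ (map f l) + sumℤ (map g l)
sumℤ-map-+ f g []      = refl
sumℤ-map-+ f g (x ∷ l) =
  trans (cong (f x + g x +_) (sumℤ-map-+ f g l))
        (+-interchange (f x) (g x) _ _)

sumℤ-map-minus : {A : Set} (f g : A → ℤ) (l : List A) →
  sumℤ (map (λ x → f x - g x) l) ≡ sumℤ (map f l) - sumℤ (map g l)
sumℤ-map-minus f g []      = refl
sumℤ-map-minus f g (x ∷ l) =
  trans (cong (f x - g x +_) (sumℤ-map-minus f g l))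
        (minus-+-interchange (f x) (g x) _ _)

module _ (Γ : Graph) where
  open Graph Γ

  private
    Σin Σout : (E → ℤ) → V → ℤ
    Σin  ω v = sumℤ (map ω (inE v))
    Σout ω v = sumℤ (map ω (outE v))

  d*-cong : {ω ω' : E → ℤ} → (∀ e → ω e ≡ ω' e) → ∀ v → d* Γ ω v ≡ d* Γ ω' v
  d*-cong ω≗ω' v =
    cong₂ _-_ (sumℤ-map-cong ω≗ω' (inE v)) (sumℤ-map-cong ω≗ω' (outE v))

  d*-+ : ∀ (ω ω' : E → ℤ) v →
    d* Γ (λ e → ω e + ω' e) v ≡ d* Γ ω v + d* Γ ω' v
  d*-+ ω ω' v =
    trans (cong₂ _-_ (sumℤ-map-+ ω ω' (inE v)) (sumℤ-map-+ ω ω' (outE v)))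
          (+-minus-interchange (Σin ω v) (Σin ω' v) (Σout ω v) (Σout ω' v))

  d*-minus : ∀ (ω ω' : E → ℤ) v →
    d* Γ (λ e → ω e - ω' e) v ≡ d* Γ ω v - d* Γ ω' v
  d*-minus ω ω' v =
    trans (cong₂ _-_ (sumℤ-map-minus ω ω' (inE v)) (sumℤ-map-minus ω ω' (outE v)))
          (minus-minus-interchange (Σin ω v) (Σin ω' v) (Σout ω v) (Σout ω' v))

  d*-zero : ∀ v → d* Γ (λ _ → 0ℤ) v ≡ 0ℤ
  d*-zero v = trans (d*-minus (λ _ → 0ℤ) (λ _ → 0ℤ) v) (+-inverseʳ (d* Γ (λ _ → 0ℤ) v))

  d-shift : ∀ (f : V → ℤ) a e → d Γ (λ v → f v - a) e ≡ d Γ f e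
  d-shift f a e =
    solve 3 (λ x y a → (x :- a) :- (y :- a) := x :- y) refl (f (t e)) (f (o e)) a

module _ (Γ : Graph) {n : ℕ} (ρ : Fin (suc n) → Graph.V Γ) where
  open Graph Γ

  χ-+-homo : ∀ x y →
    (∀ v → proj₁ (proj₁ (χ Γ ρ (_+C¹_ Γ ρ x y))) v
           ≡ proj₁ (proj₁ (χ Γ ρ x)) v + proj₁ (proj₁ (χ Γ ρ y)) v)
    × (∀ i → Σ.proj₂ (χ Γ ρ (_+C¹_ Γ ρ x y)) i
           ≡ Σ.proj₂ (χ Γ ρ x) i + Σ.proj₂ (χ Γ ρ y) i)
  χ-+-homo (ω , _) (ω' , _) = d*-+ Γ ω ω' , λ _ → refl

  χ-resp-≈ : ∀ x y → _≈P_ Γ ρ x y → _≈Cl_ Γ ρ (χ Γ ρ x) (χ Γ ρ y)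
  χ-resp-≈ (ω , _) (ω' , _) (f , a , η , η-harmonic , ω-diff , c-diff) =
    f-a , u-diff , c-diff
    where
    f-a : V → ℤ
    f-a v = f v - a

    open ≡-Reasoning
    u-diff : ∀ v → d* Γ ω v - d* Γ ω' v ≡ □₀ Γ f-a v
    u-diff v = begin
      d* Γ ω v - d* Γ ω' v               ≡⟨ d*-minus Γ ω ω' v ⟨
      d* Γ (λ e → ω e - ω' e) v          ≡⟨ d*-cong Γ ω-diff v ⟩
      d* Γ (λ e → d Γ f e + η e) v       ≡⟨ d*-+ Γ (d Γ f) η v ⟩
      □₀ Γ f v + d* Γ η v                ≡⟨ cong (□₀ Γ f v +_) (η-harmonic v) ⟩
      □₀ Γ f v + 0ℤ                      ≡⟨ +-identityʳ _ ⟩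
      □₀ Γ f v                           ≡⟨ d*-cong Γ (λ e → sym (d-shift Γ f a e)) v ⟩
      □₀ Γ f-a v                         ∎

  χ-reflect-≈ : ∀ x y → _≈Cl_ Γ ρ (χ Γ ρ x) (χ Γ ρ y) → _≈P_ Γ ρ x y
  χ-reflect-≈ (ω , _) (ω' , _) (g , u-diff , c-diff) =
    g , 0ℤ , η , η-harmonic , ω-diff , λ i → trans (c-diff i) (sym (+-identityʳ _))
    where
    η : E → ℤ
    η e = (ω e - ω' e) - d Γ g e

    ω-diff : ∀ e → ω e - ω' e ≡ d Γ g e + η e
    ω-diff e = solve 2 (λ x y → x := y :+ (x :- y)) refl (ω e - ω' e) (d Γ g e)

    η-harmonic : Harmonic Γ η
    η-harmonic v = trans (d*-minus Γ (λ e → ω e - ω' e) (d Γ g) v)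
      (trans (cong (_- □₀ Γ g v) (d*-minus Γ ω ω' v)) (i≡j⇒i-j≡0 (u-diff v)))

  χ-surjective : ∀ D → Σ (C¹ Γ ρ) λ x → _≈Cl_ Γ ρ (χ Γ ρ x) D
  χ-surjective ((_ , ω , d*ω≗u) , c) =
    (ω , c) , (λ _ → 0ℤ) ,
    (λ v → trans (i≡j⇒i-j≡0 (d*ω≗u v)) (sym (d*-zero Γ v))) ,
    (λ i → +-inverseʳ (c i))

proposition3p4p2 : (Γ : Graph) {n : ℕ} (ρ : Fin (suc n) → Graph.V Γ) →
    (∀ x y → (∀ v → proj₁ (proj₁ (χ Γ ρ (_+C¹_ Γ ρ x y))) v
                    ≡ proj₁ (proj₁ (χ Γ ρ x)) v + proj₁ (proj₁ (χ Γ ρ y)) v)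
           × (∀ i → Σ.proj₂ (χ Γ ρ (_+C¹_ Γ ρ x y)) i
                    ≡ Σ.proj₂ (χ Γ ρ x) i + Σ.proj₂ (χ Γ ρ y) i))
    × (∀ x y → _≈P_ Γ ρ x y → _≈Cl_ Γ ρ (χ Γ ρ x) (χ Γ ρ y))
    × (∀ x y → _≈Cl_ Γ ρ (χ Γ ρ x) (χ Γ ρ y) → _≈P_ Γ ρ x y)
    × (∀ D → Σ (C¹ Γ ρ) λ x → _≈Cl_ Γ ρ (χ Γ ρ x) D)
proposition3p4p2 Γ ρ =
  χ-+-homo Γ ρ , χ-resp-≈ Γ ρ , χ-reflect-≈ Γ ρ , χ-surjective Γ ρ
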